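{- Let $Q$ be a CAT(0) planar graph and fix a vertex $v\in V(Q)$. For any triangle of $Q$ with vertices $u,w,x$, the three values $\delta(u,v),\delta(w,v),\delta(x,v)$ are, in some order, $d,d+1,d+2$ for some integer $d$.
   Context: A CAT(0) planar graph is a nonempty finite connected directed graph embedded in the plane whose bounded faces are triangles with cyclically oriented edges, whose interior vertices have degree at least $6$, and in which every vertex and edge lies on some triangular face. $\delta(a,b)$ is the minimum total cost of a walk from $a$ to $b$ in the underlying graph, where traversing an edge along its orientation costs $1$ and against it costs $2$. -}

module Defs where

open import Data.Nat using (ℕ; zero; suc; _+_; _*_; _≤_)
open import Data.Fin using (Fin)
open import Data.Fin.Properties using () renaming (_≟_ to _≟ᶠ_)
open import Data.Bool using (Bool; true; false; not; if_then_else_)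
open import Data.List using (List; length; filter; allFin)
open import Data.Product using (Σ; ∃; _×_; _,_)
open import Data.Sum using (_⊎_)
open import Relation.Binary.PropositionalEquality using (_≡_; _≢_)
open import Function.Bundles using (_⇔_)

iter : ∀ {A : Set} → (A → A) → ℕ → A → A
iter f zero    a = a
iter f (suc k) a = f (iter f k a)

-- Reachability in the dart set under the generators σ and α
-- (for finite permutations this is the orbit relation of ⟨σ, α⟩).
data Reach {n : ℕ} (σ α : Fin n → Fin n) : Fin n → Fin n → Set where
  here  : ∀ {d} → Reach σ α d d
  viaσ  : ∀ {d e} → Reach σ α (σ d) e → Reach σ α d e
  viaα  : ∀ {d e} → Reach σ α (α d) e → Reach σ α d e

-- Darts are Fin nD; a dart d sits at vertex vtx d and runs along its edge to
-- vertex vtx (α d).  σ rotates darts around their vertex (the embedding),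
-- α is the edge involution, φ = σ ∘ α walks around faces.
-- Vertices (Fin nV) label σ-orbits, faces (Fin nF) label φ-orbits.
-- fwd d = true  means the directed edge of d is oriented vtx d → vtx (α d).
record OrientedPlaneGraph : Set where
  field
    nD nV nF : ℕ
    σ σ⁻ α   : Fin nD → Fin nD
    σσ⁻      : ∀ d → σ (σ⁻ d) ≡ d
    σ⁻σ      : ∀ d → σ⁻ (σ d) ≡ d
    αα       : ∀ d → α (α d) ≡ d
    α-nofix  : ∀ d → α d ≢ d
  φ : Fin nD → Fin nD
  φ d = σ (α d)
  field
    vtx       : Fin nD → Fin nV
    vtx-surj  : ∀ v → ∃ λ d → vtx d ≡ v
    vtx-orbit : ∀ d e → (vtx d ≡ vtx e) ⇔ (∃ λ k → iter σ k d ≡ e)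
    fc        : Fin nD → Fin nF
    fc-surj   : ∀ f → ∃ λ d → fc d ≡ f
    fc-orbit  : ∀ d e → (fc d ≡ fc e) ⇔ (∃ λ k → iter φ k d ≡ e)
    connected : ∀ d e → Reach σ α d e
    -- Euler's formula V - E + F = 2 with E = nD / 2 (genus 0: planar)
    euler     : 2 * (nV + nF) ≡ nD + 4
    no-loop   : ∀ d → vtx (α d) ≢ vtx d
    no-multi  : ∀ d e → vtx d ≡ vtx e → vtx (α d) ≡ vtx (α e) → d ≡ e
    fwd       : Fin nD → Bool
    fwd-α     : ∀ d → fwd (α d) ≡ not (fwd d)
    outer     : Fin nF

  degree : Fin nV → ℕ
  degree v = length (filter (λ d → vtx d ≟ᶠ v) (allFin nD))

  Bounded : Fin nD → Set
  Bounded d = fc d ≢ outer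

  Interior : Fin nV → Set
  Interior v = ∀ d → vtx d ≡ v → Bounded d

  cost : Fin nD → ℕ
  cost d = if fwd d then 1 else 2

  data Walk : Fin nV → Fin nV → ℕ → Set where
    nil  : ∀ u → Walk u u 0
    step : ∀ {u w c} (d : Fin nD) → vtx d ≡ u →
           Walk (vtx (α d)) w c → Walk u w (cost d + c)

  IsDist : Fin nV → Fin nV → ℕ → Set
  IsDist a b k = Walk a b k × (∀ c → Walk a b c → k ≤ c)

record IsCAT0Planar (Q : OrientedPlaneGraph) : Set where
  open OrientedPlaneGraph Q
  field
    bounded-triangle : ∀ d → Bounded d → iter φ 3 d ≡ d × φ d ≢ d
    bounded-cyclic   : ∀ d → Bounded d → fwd (φ d) ≡ fwd d
    interior-deg     : ∀ v → Interior v → 6 ≤ degree v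
    edge-on-triangle : ∀ d → Bounded d ⊎ Bounded (α d)
    vertex-on-triangle : ∀ v → ∃ λ d → vtx d ≡ v × Bounded d

InSomeOrder : ℕ → ℕ → ℕ → ℕ → Set
InSomeOrder a b c k =
    (a ≡ k × b ≡ k + 1 × c ≡ k + 2)
  ⊎ (a ≡ k × b ≡ k + 2 × c ≡ k + 1)
  ⊎ (a ≡ k + 1 × b ≡ k × c ≡ k + 2)
  ⊎ (a ≡ k + 1 × b ≡ k + 2 × c ≡ k)
  ⊎ (a ≡ k + 2 × b ≡ k × c ≡ k + 1)
  ⊎ (a ≡ k + 2 × b ≡ k + 1 × c ≡ k)

-- Traversing an edge costs 1 along its orientation and 2 against it, so the two directions of
-- an edge together cost 3 ≡ 0 (mod 3), and so does the boundary of a cyclically oriented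
-- triangle (3 or 6). As all bounded faces are such triangles, the cost is a coboundary mod 3:
-- there is a potential ℓ on the vertices with ℓ(head) ≡ ℓ(tail) + cost (mod 3) along every dart.
-- Hence δ(x,v) ≡ cost(x→y) + δ(y,v) (mod 3) along every edge, and together with the triangle
-- inequalities δ(x,v) ≤ cost(x→y) + δ(y,v) this leaves δ(x,v) − δ(y,v) ∈ {1, −2} along a forward
-- edge. Around a triangle the three differences sum to 0, so they are 1, 1, −2 in some order.
--
-- The potential is first defined along a breadth-first spanning tree T. The non-tree edges
-- connect all faces of the dual graph, since otherwise the edges separating two classes of faces
-- would form a leafless subgraph of T; so they contain a dual spanning tree T*, and by Euler's
-- formula every non-tree edge lies in T*. Taking the faces from the leaves of T* inwards, each
-- triangle has just one edge on which the potential condition is not yet known, and the zero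
-- total cost of the triangle settles it.

module Submission where

open import Defs
open import Level using (0ℓ)
open import Data.Nat using (ℕ; zero; suc; _+_; _*_; _∸_; _≤_; _<_; _⊔_; z≤n; s≤s; _%_)
open import Data.Nat.Properties
  using (_≟_; +-assoc; +-comm; +-identityʳ; *-distribˡ-+; ≤-refl; ≤-trans; ≤-pred; <⇒≤; <⇒≱; <-asym;
         <-≤-trans; ≤-<-trans; n≮0; 1+n≰n; n≤0⇒n≡0; m≤m⊔n; m≤n⊔m; ∸-monoʳ-<)
open import Data.Nat.DivMod using (%-distribˡ-+; [m+kn]%n≡m%n)
open import Data.Nat.Tactic.RingSolver using (solve-∀)
open import Data.Fin using (Fin; zero; suc; punchOut)
open import Data.Fin.Properties using (any?; injective⇒≤; punchOut-injective; +↔⊎; *↔×) renaming (_≟_ to _≟ᶠ_)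
open import Data.Bool using (Bool; true; false; not; if_then_else_)
import Data.Bool.Properties as Bool
open import Data.Maybe using (Maybe; just; nothing; maybe′)
import Data.Maybe as Maybe
open import Data.Maybe.Properties using (just-injective) renaming (≡-dec to ≡-dec-Maybe)
open import Data.Product using (∃; _×_; _,_; proj₁; proj₂; uncurry)
open import Data.Sum using (_⊎_; inj₁; inj₂; [_,_]′)
open import Data.Sum.Function.Propositional using (_⊎-↔_)
open import Data.Unit using (⊤; tt)
open import Function using (_∘_; _↔_; Inverse; Injection; Equivalence; mk⇔)
open import Function.Definitions using (Injective)
open import Function.Properties.Inverse using (↔-sym; ↔-trans; ↔-refl; ↔⇒↣)
import Function.Construct.Composition as Comp
open import Relation.Nullary using (¬_; Dec; yes; no; contradiction; does)
open import Relation.Nullary.Decidable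
  using (map′; _⊎-dec_; _×-dec_; ¬?; dec-true; dec-false; does-⇔; decidable-stable; ¬¬-excluded-middle)
open import Relation.Nullary.Negation using (¬¬-map)
open import Relation.Unary using (Decidable)
open import Relation.Binary.Bundles using (Setoid)
import Relation.Binary.Reasoning.Setoid as SetoidReasoning
open import Relation.Binary.PropositionalEquality
  using (_≡_; _≢_; refl; sym; trans; cong; subst; subst₂; module ≡-Reasoning)

Least : (ℕ → Set) → ℕ → Set
Least P m = P m × (∀ n → P n → m ≤ n)

least : ∀ {P : ℕ → Set} → Decidable P → ∀ n → P n → ∃ (Least P)
least P? zero    p = zero , p , λ _ _ → z≤n
least P? (suc n) p with P? zero
... | yes p₀ = zero , p₀ , λ _ _ → z≤n
... | no ¬p₀ with least (P? ∘ suc) n p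
...   | m , pm , minimal = suc m , pm , λ { zero    p₀ → contradiction p₀ ¬p₀
                                        ; (suc j) pj → s≤s (minimal j pj) }

upper-bound : ∀ {n} (f : Fin n → ℕ) → ∃ λ D → ∀ i → f i ≤ D
upper-bound {zero}  f = 0 , λ ()
upper-bound {suc n} f with upper-bound (f ∘ suc)
... | D , bounded = f zero ⊔ D , λ { zero    → m≤m⊔n (f zero) D
                                  ; (suc i) → ≤-trans (bounded i) (m≤n⊔m (f zero) D) }

¬¬-∀-Fin : ∀ {n} {P : Fin n → Set} → (∀ i → ¬ ¬ P i) → ¬ ¬ (∀ i → P i)
¬¬-∀-Fin {zero}  _ k = k λ ()
¬¬-∀-Fin {suc n} h k = h zero λ p₀ → ¬¬-∀-Fin (h ∘ suc) λ ps → k λ { zero → p₀ ; (suc i) → ps i }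

injective⇒surjective : ∀ {n} (f : Fin n → Fin n) → Injective _≡_ _≡_ f → ∀ y → ∃ λ x → f x ≡ y
injective⇒surjective {suc n} f f-injective y with any? (λ x → f x ≟ᶠ y)
... | yes found = found
... | no missed = contradiction (injective⇒≤ g-injective) 1+n≰n
  where
  g : Fin (suc n) → Fin n
  g x = punchOut {i = y} λ y≡fx → missed (x , sym y≡fx)
  g-injective : Injective _≡_ _≡_ g
  g-injective eq = f-injective (punchOut-injective {i = y} _ _ eq)

↔-injective⇒surjective : ∀ {m n} {A B : Set} → A ↔ Fin m → B ↔ Fin n → m ≡ n →
                         (f : A → B) → Injective _≡_ _≡_ f → ∀ y → ∃ λ x → f x ≡ y
↔-injective⇒surjective A↔ B↔ refl f f-injective y = lift (injective⇒surjective g g-injective (B.to y))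
  where
  module A = Inverse A↔
  module B = Inverse B↔
  g : Fin _ → Fin _
  g = B.to ∘ f ∘ A.from
  g-injective : Injective _≡_ _≡_ g
  g-injective = Comp.injective _≡_ _≡_ _≡_
    (Comp.injective _≡_ _≡_ _≡_ (Injection.injective (↔⇒↣ (↔-sym A↔))) f-injective)
    (Injection.injective (↔⇒↣ B↔))
  lift : (∃ λ i → g i ≡ B.to y) → ∃ λ x → f x ≡ y
  lift (i , gi≡y) = A.from i , (begin
    f (A.from i)                  ≡⟨ B.strictlyInverseʳ _ ⟨
    B.from (g i)                  ≡⟨ cong B.from gi≡y ⟩
    B.from (B.to y)               ≡⟨ B.strictlyInverseʳ y ⟩
    y                             ∎)
    where open ≡-Reasoning

infix 4 _≡₃_

record _≡₃_ (m n : ℕ) : Set where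
  constructor residues
  field residue : m % 3 ≡ n % 3

open _≡₃_

≡₃-setoid : Setoid 0ℓ 0ℓ
≡₃-setoid = record
  { Carrier       = ℕ
  ; _≈_           = _≡₃_
  ; isEquivalence = record
    { refl  = residues refl
    ; sym   = λ m≡n → residues (sym (residue m≡n))
    ; trans = λ m≡n n≡o → residues (trans (residue m≡n) (residue n≡o))
    }
  }

module ≡₃-Reasoning = SetoidReasoning ≡₃-setoid

≡₃-+ˡ : ∀ k {m n} → m ≡₃ n → k + m ≡₃ k + n
≡₃-+ˡ k {m} {n} m≡n = residues (trans (%-distribˡ-+ k m 3)
  (trans (cong (λ i → (k % 3 + i) % 3) (residue m≡n)) (sym (%-distribˡ-+ k n 3))))

≡₃-+ʳ : ∀ k {m n} → m ≡₃ n → m + k ≡₃ n + k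
≡₃-+ʳ k {m} {n} m≡n = begin
  m + k   ≡⟨ +-comm m k ⟩
  k + m   ≈⟨ ≡₃-+ˡ k m≡n ⟩
  k + n   ≡⟨ +-comm k n ⟩
  n + k   ∎
  where open ≡₃-Reasoning

m+k*3≡₃m : ∀ m k → m + k * 3 ≡₃ m
m+k*3≡₃m m k = residues ([m+kn]%n≡m%n m k 3)

≡₃-cancelˡ : ∀ k {m n} → k + m ≡₃ k + n → m ≡₃ n
≡₃-cancelˡ k {m} {n} k+m≡k+n = begin
  m                 ≈⟨ m+k*3≡₃m m k ⟨
  m + k * 3         ≡⟨ regroup m k ⟩
  2 * k + (k + m)   ≈⟨ ≡₃-+ˡ (2 * k) k+m≡k+n ⟩
  2 * k + (k + n)   ≡⟨ regroup n k ⟨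
  n + k * 3         ≈⟨ m+k*3≡₃m n k ⟩
  n                 ∎
  where
  open ≡₃-Reasoning
  regroup : ∀ i j → i + j * 3 ≡ 2 * j + (j + i)
  regroup = solve-∀

≡₃-flip : ∀ {x y a b} → y ≡₃ x + a → a + b ≡₃ 0 → x ≡₃ y + b
≡₃-flip {x} {y} {a} {b} y≡x+a closed = Setoid.sym ≡₃-setoid (begin
  y + b         ≈⟨ ≡₃-+ʳ b y≡x+a ⟩
  x + a + b     ≡⟨ +-assoc x a b ⟩
  x + (a + b)   ≈⟨ ≡₃-+ˡ x closed ⟩
  x + 0         ≡⟨ +-identityʳ x ⟩
  x             ∎)
  where open ≡₃-Reasoning

≡₃-triangle : ∀ {x y z a b c} → z ≡₃ y + b → x ≡₃ z + c → a + b + c ≡₃ 0 → y ≡₃ x + a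
≡₃-triangle {x} {y} {z} {a} {b} {c} z≡y+b x≡z+c closed = Setoid.sym ≡₃-setoid (begin
  x + a             ≈⟨ ≡₃-+ʳ a x≡z+c ⟩
  z + c + a         ≈⟨ ≡₃-+ʳ a (≡₃-+ʳ c z≡y+b) ⟩
  y + b + c + a     ≡⟨ regroup y a b c ⟩
  y + (a + b + c)   ≈⟨ ≡₃-+ˡ y closed ⟩
  y + 0             ≡⟨ +-identityʳ y ⟩
  y                 ∎)
  where
  open ≡₃-Reasoning
  regroup : ∀ y a b c → y + b + c + a ≡ y + (a + b + c)
  regroup = solve-∀

-- the possible distances to a fixed vertex from the tail (p) and head (q) of a forward edge
infix 4 _↝_

data _↝_ : ℕ → ℕ → Set where
  closer  : ∀ {q} → suc q ↝ q
  farther : ∀ {p} → p ↝ 2 + p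

↝-suc : ∀ {p q} → p ↝ q → suc p ↝ suc q
↝-suc closer  = closer
↝-suc farther = farther

↝-from-bounds : ∀ {p q} → p ≤ 1 + q → q ≤ 2 + p → p ≡₃ 1 + q → p ↝ q
↝-from-bounds {0}           {0}     _ _ (residues ())
↝-from-bounds {0}           {1}     _ _ (residues ())
↝-from-bounds {0}           {2}     _ _ _ = farther
↝-from-bounds {0}           {suc (suc (suc _))} _ (s≤s (s≤s ())) _
↝-from-bounds {1}           {0}     _ _ _ = closer
↝-from-bounds {suc (suc _)} {0}     (s≤s ()) _ _
↝-from-bounds {suc p}       {suc q} (s≤s p≤) (s≤s q≤) p≡ =
  ↝-suc (↝-from-bounds p≤ q≤ (≡₃-cancelˡ 1 p≡))

Along : Bool → ℕ → ℕ → Set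
Along true  p q = p ↝ q
Along false p q = q ↝ p

-- Only two closer steps and one farther step add up to zero around a cycle; Agda rules out the
-- other patterns by unification.
along-cycle : ∀ o {a b c} → Along o a b → Along o b c → Along o c a → ∃ (InSomeOrder a b c)
along-cycle true  {c = c} closer  closer  farther =
  c , inj₂ (inj₂ (inj₂ (inj₂ (inj₂ (+-comm 2 c , +-comm 1 c , refl)))))
along-cycle true  {b = b} closer  farther closer =
  b , inj₂ (inj₂ (inj₁ (+-comm 1 b , refl , +-comm 2 b)))
along-cycle true  {a = a} farther closer  closer =
  a , inj₂ (inj₁ (refl , +-comm 2 a , +-comm 1 a))
along-cycle false {a = a} closer  closer  farther =
  a , inj₁ (refl , +-comm 1 a , +-comm 2 a)
along-cycle false {c = c} closer  farther closer =
  c , inj₂ (inj₂ (inj₂ (inj₁ (+-comm 1 c , +-comm 2 c , refl))))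
along-cycle false {b = b} farther closer  closer =
  b , inj₂ (inj₂ (inj₂ (inj₂ (inj₁ (+-comm 2 b , refl , +-comm 1 b)))))

-- A graph presented by darts with an involution α and endpoint labels lab; the vertex graph
-- (lab = vtx) and the dual graph (lab = fc) are both instances.
module Layering {nD n : ℕ} (α : Fin nD → Fin nD) (αα : ∀ d → α (α d) ≡ d) (lab : Fin nD → Fin n)
                (Allowed : Fin nD → Set) (allowed? : Decidable Allowed) (root : Fin n) where

  Within : ℕ → Fin n → Set
  Within zero    x = x ≡ root
  Within (suc k) x = Within k x ⊎ ∃ λ d → lab d ≡ x × Allowed d × Within k (lab (α d))

  within? : ∀ k → Decidable (Within k)
  within? zero    x = x ≟ᶠ root
  within? (suc k) x = within? k x ⊎-dec any? λ d → lab d ≟ᶠ x ×-dec allowed? d ×-dec within? k (lab (α d))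

  orient : Fin 2 → Fin nD → Fin nD
  orient zero       d = d
  orient (suc zero) d = α d

  orient-involutive : ∀ b d → orient b (orient b d) ≡ d
  orient-involutive zero       d = refl
  orient-involutive (suc zero) d = αα d

  Reachable : Fin n → Set
  Reachable x = ∃ λ k → Within k x

  reachable-step : ∀ d → Allowed d → Reachable (lab (α d)) → Reachable (lab d)
  reachable-step d a (k , w) = suc k , inj₂ (d , refl , a , w)

  module Parents (reachable : ∀ x → Reachable x) where

    private
      shortest : ∀ x → ∃ (Least λ k → Within k x)
      shortest x = least (λ k → within? k x) (proj₁ (reachable x)) (proj₂ (reachable x))

    depth : Fin n → ℕ
    depth x = proj₁ (shortest x)

    depth-minimal : ∀ {k x} → Within k x → depth x ≤ k
    depth-minimal {k} {x} w = proj₂ (proj₂ (shortest x)) k w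

    depth-root : depth root ≡ 0
    depth-root = n≤0⇒n≡0 (depth-minimal refl)

    Descent : Fin n → ℕ → Set
    Descent x m = ∃ λ d → lab d ≡ x × Allowed d × depth (lab (α d)) < m

    private
      descent-below : ∀ {x m} → Least (λ k → Within k x) m → x ≡ root ⊎ Descent x m
      descent-below {m = zero}  (w , _) = inj₁ w
      descent-below {m = suc k} (inj₁ w , minimal) = contradiction (minimal k w) 1+n≰n
      descent-below {m = suc k} (inj₂ (d , lab≡x , a , w) , _) = inj₂ (d , lab≡x , a , s≤s (depth-minimal w))

    descent-or-root : ∀ x → x ≡ root ⊎ Descent x (depth x)
    descent-or-root x = descent-below (proj₂ (shortest x))

    parent : Fin n → Maybe (Fin nD)
    parent x = [ (λ _ → nothing) , just ∘ proj₁ ]′ (descent-or-root x)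

    ToParent : Fin nD → Set
    ToParent d = parent (lab d) ≡ just d

    toParent? : Decidable ToParent
    toParent? d = ≡-dec-Maybe _≟ᶠ_ (parent (lab d)) (just d)

    parent-spec : ∀ {x d} → parent x ≡ just d → lab d ≡ x × Allowed d × depth (lab (α d)) < depth x
    parent-spec {x} eq with descent-or-root x
    parent-spec {x} refl | inj₂ (_ , spec) = spec

    parent-root : ∀ {x} → parent x ≡ nothing → x ≡ root
    parent-root {x} eq with descent-or-root x
    parent-root {x} refl | inj₁ x≡root = x≡root

    parent-toParent : ∀ {x d} → parent x ≡ just d → ToParent d
    parent-toParent {x} {d} eq = subst (λ y → parent y ≡ just d) (sym (proj₁ (parent-spec eq))) eq

    toParent-allowed : ∀ {d} → ToParent d → Allowed d
    toParent-allowed toParent = proj₁ (proj₂ (parent-spec toParent))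

    toParent-depth : ∀ {d} → ToParent d → depth (lab (α d)) < depth (lab d)
    toParent-depth toParent = proj₂ (proj₂ (parent-spec toParent))

    toParent-unique : ∀ {d e} → ToParent d → ToParent e → lab d ≡ lab e → d ≡ e
    toParent-unique toParent-d toParent-e eq =
      just-injective (trans (sym toParent-d) (trans (cong parent eq) toParent-e))

    toParent-exists : ∀ {x} → x ≢ root → ∃ λ d → lab d ≡ x × ToParent d
    toParent-exists {x} x≢root with descent-or-root x in eq
    ... | inj₁ x≡root = contradiction x≡root x≢root
    ... | inj₂ (d , lab≡x , _) = d , lab≡x , parent-toParent (cong [ (λ _ → nothing) , just ∘ proj₁ ]′ eq)

    toParent-≢root : ∀ {d} → ToParent d → lab d ≢ root
    toParent-≢root {d} toParent lab≡root =
      n≮0 (subst (depth (lab (α d)) <_) (trans (cong depth lab≡root) depth-root) (toParent-depth toParent))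

    toParent-¬α : ∀ {d} → ToParent d → ¬ ToParent (α d)
    toParent-¬α {d} toParent-d toParent-αd = <-asym (toParent-depth toParent-d)
      (subst (λ e → depth (lab e) < depth (lab (α d))) (αα d) (toParent-depth toParent-αd))

    toParent-orient : ∀ b {d} → ToParent (orient b d) → ToParent d ⊎ ToParent (α d)
    toParent-orient zero       toParent = inj₁ toParent
    toParent-orient (suc zero) toParent = inj₂ toParent

    orientedParent : Fin 2 → Fin n → Maybe (Fin nD)
    orientedParent b x = Maybe.map (orient b) (parent x)

    orientedParent-root : ∀ b {x} → orientedParent b x ≡ nothing → x ≡ root
    orientedParent-root b {x} eq with parent x in p
    ... | nothing = parent-root p

    orientedParent-toParent : ∀ b {x d} → orientedParent b x ≡ just d → ToParent (orient b d)
    orientedParent-toParent b {x} eq with parent x in p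
    orientedParent-toParent b refl | just d = subst ToParent (sym (orient-involutive b d)) (parent-toParent p)

    childOf : Fin nD → Fin 2 × Fin n
    childOf d with toParent? d
    ... | yes _ = zero , lab d
    ... | no _  = suc zero , lab (α d)

    childOf-orientedParent : ∀ b {x d} → orientedParent b x ≡ just d → childOf d ≡ (b , x)
    childOf-orientedParent b {x} eq with parent x in p
    childOf-orientedParent zero {x} refl | just d with toParent? d
    ... | yes _ = cong (zero ,_) (proj₁ (parent-spec p))
    ... | no ¬toParent = contradiction (parent-toParent p) ¬toParent
    childOf-orientedParent (suc zero) {x} refl | just d with toParent? (α d)
    ... | yes toParent-αd = contradiction toParent-αd (toParent-¬α (parent-toParent p))
    ... | no _ = cong (suc zero ,_) (trans (cong lab (αα d)) (proj₁ (parent-spec p)))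

module PlaneGraph (Q : OrientedPlaneGraph) where
  open OrientedPlaneGraph Q

  vtx-σ : ∀ d → vtx (σ d) ≡ vtx d
  vtx-σ d = sym (Equivalence.from (vtx-orbit d (σ d)) (1 , refl))

  vtx-iterσ : ∀ k d → vtx (iter σ k d) ≡ vtx d
  vtx-iterσ zero    d = refl
  vtx-iterσ (suc k) d = trans (vtx-σ (iter σ k d)) (vtx-iterσ k d)

  vtx-φ : ∀ d → vtx (φ d) ≡ vtx (α d)
  vtx-φ d = vtx-σ (α d)

  fc-φ : ∀ d → fc (φ d) ≡ fc d
  fc-φ d = sym (Equivalence.from (fc-orbit d (φ d)) (1 , refl))

  fc-σ : ∀ d → fc (σ d) ≡ fc (α d)
  fc-σ d = trans (cong (fc ∘ σ) (sym (αα d))) (fc-φ (α d))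

  rotation-invariant : ∀ {X : Set} (g : Fin nD → X) d →
                       (∀ e → vtx e ≡ vtx d → e ≢ d → g (σ e) ≡ g e) → g d ≡ g (σ d)
  rotation-invariant g d invariant =
    first-return (uncurry (least (λ k → iter σ k (σ d) ≟ᶠ d)) (Equivalence.to (vtx-orbit (σ d) d) (vtx-σ d)))
    where
    first-return : ∃ (Least λ k → iter σ k (σ d) ≡ d) → g d ≡ g (σ d)
    first-return (m , returns , minimal) = trans (cong g (sym returns)) (along m ≤-refl)
      where
      along : ∀ i → i ≤ m → g (iter σ i (σ d)) ≡ g (σ d)
      along zero    _   = refl
      along (suc i) i<m = trans (invariant c (trans (vtx-iterσ i (σ d)) (vtx-σ d)) c≢d) (along i (<⇒≤ i<m))
        where
        c : Fin nD
        c = iter σ i (σ d)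
        c≢d : c ≢ d
        c≢d c≡d = <⇒≱ i<m (minimal i c≡d)

  module SpanningTree (r : Fin nV) where

    module VL = Layering α αα vtx (λ _ → ⊤) (λ _ → yes tt) r

    reach-vertex : ∀ {d e} → Reach σ α d e → VL.Reachable (vtx e) → VL.Reachable (vtx d)
    reach-vertex here        reachable = reachable
    reach-vertex (viaσ {d} p) reachable = subst VL.Reachable (vtx-σ d) (reach-vertex p reachable)
    reach-vertex (viaα {d} p) reachable = VL.reachable-step d tt (reach-vertex p reachable)

    vertex-reachable : ∀ x → VL.Reachable x
    vertex-reachable x with e , refl ← vtx-surj x | e₀ , vtx≡r ← vtx-surj r =
      reach-vertex (connected e e₀) (0 , vtx≡r)

    module V = VL.Parents vertex-reachable

    TreeDart : Fin nD → Set
    TreeDart d = V.ToParent d ⊎ V.ToParent (α d)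

    treeDart? : ∀ d → Dec (TreeDart d)
    treeDart? d = V.toParent? d ⊎-dec V.toParent? (α d)

    NonTree : Fin nD → Set
    NonTree d = ¬ TreeDart d

    nonTree-α : ∀ {d} → NonTree d → NonTree (α d)
    nonTree-α     nt (inj₁ toParent) = nt (inj₂ toParent)
    nonTree-α {d} nt (inj₂ toParent) = nt (inj₁ (subst V.ToParent (αα d) toParent))

    -- The edges separating the two classes of s would form a leafless subgraph of the tree.
    module Separation (s : Fin nF → Bool) (uniform : ∀ d → NonTree d → s (fc d) ≡ s (fc (α d))) where

      Separates : Fin nD → Set
      Separates d = s (fc d) ≢ s (fc (α d))

      separates? : ∀ d → Dec (Separates d)
      separates? d = ¬? (s (fc d) Bool.≟ s (fc (α d)))

      separates-α : ∀ {d} → Separates d → Separates (α d)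
      separates-α {d} sep eq = sep (sym (trans eq (cong (s ∘ fc) (αα d))))

      separates-tree : ∀ {d} → Separates d → TreeDart d
      separates-tree {d} sep with treeDart? d
      ... | yes tree = tree
      ... | no nt    = contradiction (uniform d nt) sep

      separating-path : ∀ {d e} → Reach σ α d e → s (fc d) ≢ s (fc e) → ∃ Separates
      separating-path here        differ = contradiction refl differ
      separating-path (viaσ {d} p) differ with s (fc d) Bool.≟ s (fc (α d))
      ... | yes same = separating-path p λ eq → differ (trans same (trans (cong s (sym (fc-σ d))) eq))
      ... | no sep   = d , sep
      separating-path (viaα {d} p) differ with s (fc d) Bool.≟ s (fc (α d))
      ... | yes same = separating-path p λ eq → differ (trans same eq)
      ... | no sep   = d , sep

      another-separating : ∀ {d} → Separates d → ∃ λ e → vtx e ≡ vtx d × e ≢ d × Separates e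
      another-separating {d} sep with any? (λ e → vtx e ≟ᶠ vtx d ×-dec ¬? (e ≟ᶠ d) ×-dec separates? e)
      ... | yes found = found
      ... | no none   = contradiction (trans (rotation-invariant (s ∘ fc) d uniform-here) (cong s (fc-σ d))) sep
        where
        uniform-here : ∀ e → vtx e ≡ vtx d → e ≢ d → s (fc (σ e)) ≡ s (fc e)
        uniform-here e same-vtx e≢d with s (fc e) Bool.≟ s (fc (α e))
        ... | yes same = trans (cong s (fc-σ e)) (sym same)
        ... | no sep-e = contradiction (e , same-vtx , e≢d , sep-e) none

      deep-separating : ∀ {d} → Separates d → ∀ k → ∃ λ e → Separates e × V.ToParent e × k ≤ V.depth (vtx e)
      deep-separating {d} sep zero with separates-tree sep
      ... | inj₁ toParent = d , sep , toParent , z≤n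
      ... | inj₂ toParent = α d , separates-α sep , toParent , z≤n
      deep-separating sep (suc k) with deep-separating sep k
      ... | e , sep-e , toParent-e , k≤depth with another-separating sep-e
      ... | e′ , same-vtx , e′≢e , sep-e′ with separates-tree sep-e′
      ... | inj₁ toParent-e′  = contradiction (V.toParent-unique toParent-e′ toParent-e same-vtx) e′≢e
      ... | inj₂ toParent-αe′ = α e′ , separates-α sep-e′ , toParent-αe′ , ≤-<-trans k≤depth deeper
        where
        deeper : V.depth (vtx e) < V.depth (vtx (α e′))
        deeper = subst (λ x → V.depth x < V.depth (vtx (α e′)))
                       (trans (cong vtx (αα e′)) same-vtx) (V.toParent-depth toParent-αe′)

      no-separating : ∀ {d} → ¬ Separates d
      no-separating sep with upper-bound V.depth
      ... | D , bounded with deep-separating sep (suc D)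
      ... | e , _ , _ , deep = 1+n≰n (≤-trans deep (bounded (vtx e)))

      constant : ∀ f g → s f ≡ s g
      constant f g with d , refl ← fc-surj f | e , refl ← fc-surj g
        = decidable-stable (s (fc d) Bool.≟ s (fc e)) λ differ →
            no-separating (proj₂ (separating-path (connected d e) differ))

    nonTree-orient : ∀ b {d} → NonTree (VL.orient b d) → NonTree d
    nonTree-orient zero       nt = nt
    nonTree-orient (suc zero) {d} nt = subst NonTree (αα d) (nonTree-α nt)

    nonTree? : ∀ d → Dec (NonTree d)
    nonTree? d = ¬? (treeDart? d)

    module FL = Layering α αα fc NonTree nonTree? outer

    -- Only under ¬¬, as Separation needs a decidable labelling; this suffices since the
    -- potential condition is decidable (see ℓ-potential).
    faces-reachable : ¬ ¬ (∀ f → FL.Reachable f)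
    faces-reachable = ¬¬-map reachable-if-decidable (¬¬-∀-Fin λ _ → ¬¬-excluded-middle)
      where
      reachable-if-decidable : (∀ f → Dec (FL.Reachable f)) → ∀ f → FL.Reachable f
      reachable-if-decidable reachable? f = decidable-stable (reachable? f) λ unreachable → contradiction (begin
        true                      ≡⟨ dec-true (reachable? outer) (0 , refl) ⟨
        does (reachable? outer)   ≡⟨ constant outer f ⟩
        does (reachable? f)       ≡⟨ dec-false (reachable? f) unreachable ⟩
        false                     ∎) λ ()
        where
        open ≡-Reasoning
        uniform : ∀ d → NonTree d → does (reachable? (fc d)) ≡ does (reachable? (fc (α d)))
        uniform d nt = does-⇔ (mk⇔ forward (FL.reachable-step d nt)) (reachable? (fc d)) (reachable? (fc (α d)))
          where
          forward : FL.Reachable (fc d) → FL.Reachable (fc (α d))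
          forward = FL.reachable-step (α d) (nonTree-α nt) ∘ subst FL.Reachable (cong fc (sym (αα d)))
        open Separation (λ g → does (reachable? g)) uniform

    module DualTree (face-reachable : ∀ f → FL.Reachable f) where

      module F = FL.Parents face-reachable

      Code : Set
      Code = (Fin 2 × Fin nV) ⊎ (Fin 2 × Fin nF)

      Dart⁺ : Set
      Dart⁺ = (Fin 2 ⊎ Fin 2) ⊎ Fin nD

      -- A vertex x ≢ r yields both orientations of its tree edge to the parent, a face f ≢ outer
      -- those of its dual tree edge; the two roots go to the four extra elements. Both sides have
      -- 2 (nV + nF) = nD + 4 elements by Euler's formula, so every dart lies on one of the two trees.
      encode : Code → Dart⁺
      encode (inj₁ (b , x)) = maybe′ inj₂ (inj₁ (inj₁ b)) (V.orientedParent b x)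
      encode (inj₂ (b , f)) = maybe′ inj₂ (inj₁ (inj₂ b)) (F.orientedParent b f)

      decode : Dart⁺ → Code
      decode (inj₁ (inj₁ b)) = inj₁ (b , r)
      decode (inj₁ (inj₂ b)) = inj₂ (b , outer)
      decode (inj₂ d) with treeDart? d
      ... | yes _ = inj₁ (V.childOf d)
      ... | no _  = inj₂ (F.childOf d)

      decode-encode : ∀ c → decode (encode c) ≡ c
      decode-encode (inj₁ (b , x)) with V.orientedParent b x in eq
      ... | nothing = cong (λ y → inj₁ (b , y)) (sym (V.orientedParent-root b eq))
      ... | just d with treeDart? d
      ...   | yes _  = cong inj₁ (V.childOf-orientedParent b eq)
      ...   | no nt  = contradiction (V.toParent-orient b (V.orientedParent-toParent b eq)) nt
      decode-encode (inj₂ (b , f)) with F.orientedParent b f in eq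
      ... | nothing = cong (λ g → inj₂ (b , g)) (sym (F.orientedParent-root b eq))
      ... | just d with treeDart? d
      ...   | yes tree = contradiction tree (nonTree-orient b (F.toParent-allowed (F.orientedParent-toParent b eq)))
      ...   | no _     = cong inj₂ (F.childOf-orientedParent b eq)

      encode-injective : Injective _≡_ _≡_ encode
      encode-injective {c} {c′} eq = trans (sym (decode-encode c)) (trans (cong decode eq) (decode-encode c′))

      encode-surjective : ∀ y → ∃ λ c → encode c ≡ y
      encode-surjective = ↔-injective⇒surjective Code↔ Dart⁺↔ sizes encode encode-injective
        where
        Code↔ : Code ↔ Fin (2 * nV + 2 * nF)
        Code↔ = ↔-sym (↔-trans +↔⊎ (*↔× ⊎-↔ *↔×))
        Dart⁺↔ : Dart⁺ ↔ Fin (4 + nD)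
        Dart⁺↔ = ↔-sym (↔-trans +↔⊎ (+↔⊎ ⊎-↔ ↔-refl))
        sizes : 2 * nV + 2 * nF ≡ 4 + nD
        sizes = trans (sym (*-distribˡ-+ 2 nV nF)) (trans euler (+-comm nD 4))

      dart-classification : ∀ d → TreeDart d ⊎ F.ToParent d ⊎ F.ToParent (α d)
      dart-classification d with encode-surjective (inj₂ d)
      ... | inj₁ (b , x) , eq with V.orientedParent b x in he
      ...   | nothing = contradiction eq λ ()
      ...   | just _ with refl ← eq = inj₁ (V.toParent-orient b (V.orientedParent-toParent b he))
      dart-classification d | inj₂ (b , f) , eq with F.orientedParent b f in he
      ...   | nothing = contradiction eq λ ()
      ...   | just _ with refl ← eq = inj₂ (F.toParent-orient b (F.orientedParent-toParent b he))

  PotentialAt : (Fin nD → ℕ) → (Fin nV → ℕ) → Fin nD → Set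
  PotentialAt w ℓ d = ℓ (vtx (α d)) ≡₃ ℓ (vtx d) + w d

  IsPotential : (Fin nD → ℕ) → (Fin nV → ℕ) → Set
  IsPotential w ℓ = ∀ d → PotentialAt w ℓ d

  module PotentialConstruction
    (w : Fin nD → ℕ) (w-α : ∀ d → w (α d) + w d ≡₃ 0)
    (triangular : ∀ d → Bounded d → iter φ 3 d ≡ d × φ d ≢ d)
    (w-triangle : ∀ d → Bounded d → w d + w (φ d) + w (φ (φ d)) ≡₃ 0)
    (r : Fin nV) where

    open SpanningTree r

    -- the weight of the tree path from r to x, given fuel n > V.depth x
    pathWeight : ℕ → Fin nV → ℕ
    pathWeight zero    x = 0
    pathWeight (suc n) x = maybe′ (λ d → pathWeight n (vtx (α d)) + w (α d)) 0 (V.parent x)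

    pathWeight-stable : ∀ {m n} x → V.depth x < m → V.depth x < n → pathWeight m x ≡ pathWeight n x
    pathWeight-stable {suc m} {suc n} x (s≤s depth≤m) (s≤s depth≤n) with V.parent x in eq
    ... | nothing = refl
    ... | just d  = cong (_+ w (α d))
                      (pathWeight-stable (vtx (α d)) (<-≤-trans shallower depth≤m) (<-≤-trans shallower depth≤n))
      where
      shallower : V.depth (vtx (α d)) < V.depth x
      shallower = proj₂ (proj₂ (V.parent-spec eq))

    ℓ : Fin nV → ℕ
    ℓ x = pathWeight (suc (V.depth x)) x

    ℓ-toParent : ∀ {d} → V.ToParent d → ℓ (vtx d) ≡ ℓ (vtx (α d)) + w (α d)
    ℓ-toParent {d} toParent = trans (cong (maybe′ _ 0) toParent)
      (cong (_+ w (α d)) (pathWeight-stable (vtx (α d)) (V.toParent-depth toParent) ≤-refl))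

    Fits : Fin nD → Set
    Fits = PotentialAt w ℓ

    fits? : ∀ d → Dec (Fits d)
    fits? d = map′ residues residue (ℓ (vtx (α d)) % 3 ≟ (ℓ (vtx d) + w d) % 3)

    fits-α : ∀ {d} → Fits (α d) → Fits d
    fits-α {d} fit = ≡₃-flip (subst (λ e → ℓ (vtx e) ≡₃ ℓ (vtx (α d)) + w (α d)) (αα d) fit) (w-α d)

    fits-tree : ∀ {d} → TreeDart d → Fits d
    fits-tree (inj₁ toParent) = ≡₃-flip (residues (cong (_% 3) (ℓ-toParent toParent))) (w-α _)
    fits-tree (inj₂ toParent) = fits-α (fits-tree (inj₁ toParent))

    fits-triangle : ∀ {d} → Bounded d → Fits (φ d) → Fits (φ (φ d)) → Fits d
    fits-triangle {d} bounded fit₁ fit₂ = ≡₃-triangle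
      (subst (λ u → ℓ (vtx (α (φ d))) ≡₃ ℓ u + w (φ d)) (vtx-φ d) fit₁)
      (subst₂ (λ u u′ → ℓ u ≡₃ ℓ u′ + w (φ (φ d))) closes (vtx-φ (φ d)) fit₂)
      (w-triangle d bounded)
      where
      closes : vtx (α (φ (φ d))) ≡ vtx d
      closes = trans (sym (vtx-φ (φ (φ d)))) (cong vtx (proj₁ (triangular d bounded)))

    module _ (face-reachable : ∀ f → FL.Reachable f) where
      open DualTree face-reachable

      AllFit : Fin nF → Set
      AllFit f = ∀ d → fc d ≡ f → Fits d

      Deeper : Fin nF → Set
      Deeper f = ∀ g → F.depth f < F.depth g → AllFit g

      fits-besides-parent : ∀ {d₀ e} → F.ToParent d₀ → Deeper (fc d₀) → fc e ≡ fc d₀ → e ≢ d₀ → Fits e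
      fits-besides-parent {d₀} {e} toParent₀ deeper same-face e≢d₀ with dart-classification e
      ... | inj₁ tree              = fits-tree tree
      ... | inj₂ (inj₁ toParent)   = contradiction (F.toParent-unique toParent toParent₀ same-face) e≢d₀
      ... | inj₂ (inj₂ toParent-α) = fits-α (deeper (fc (α e)) child (α e) refl)
        where
        child : F.depth (fc d₀) < F.depth (fc (α e))
        child = subst (λ g → F.depth g < F.depth (fc (α e)))
                      (trans (cong fc (αα e)) same-face) (F.toParent-depth toParent-α)

      fits-parent-face : ∀ {d₀} → F.ToParent d₀ → Deeper (fc d₀) → AllFit (fc d₀)
      fits-parent-face {d₀} toParent₀ deeper e same-face with e ≟ᶠ d₀
      ... | no e≢d₀ = fits-besides-parent toParent₀ deeper same-face e≢d₀
      ... | yes refl = fits-triangle bounded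
            (fits-besides-parent toParent₀ deeper (fc-φ d₀) φd₀≢d₀)
            (fits-besides-parent toParent₀ deeper (trans (fc-φ (φ d₀)) (fc-φ d₀)) φφd₀≢d₀)
        where
        bounded : Bounded d₀
        bounded = F.toParent-≢root toParent₀
        φd₀≢d₀ : φ d₀ ≢ d₀
        φd₀≢d₀ = proj₂ (triangular d₀ bounded)
        φφd₀≢d₀ : φ (φ d₀) ≢ d₀
        φφd₀≢d₀ eq = φd₀≢d₀ (trans (cong φ (sym eq)) (proj₁ (triangular d₀ bounded)))

      fits-face : ∀ {f} → f ≢ outer → Deeper f → AllFit f
      fits-face f≢outer deeper with d₀ , refl , toParent₀ ← F.toParent-exists f≢outer =
        fits-parent-face toParent₀ deeper

      height : Fin nF → ℕ
      height f = proj₁ (upper-bound F.depth) ∸ F.depth f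

      height-decreasing : ∀ {f g} → F.depth f < F.depth g → height g < height f
      height-decreasing {g = g} f<g = ∸-monoʳ-< f<g (proj₂ (upper-bound F.depth) g)

      fits-by-height : ∀ h {f} → f ≢ outer → height f ≤ h → AllFit f
      fits-by-height h {f} f≢outer height≤h = fits-face f≢outer (deeper h height≤h)
        where
        deeper : ∀ h → height f ≤ h → Deeper f
        deeper zero    height≤0 g f<g = contradiction (<-≤-trans (height-decreasing f<g) height≤0) n≮0
        deeper (suc h) height≤h g f<g =
          fits-by-height h g≢outer (≤-pred (<-≤-trans (height-decreasing f<g) height≤h))
          where
          g≢outer : g ≢ outer
          g≢outer refl = n≮0 (subst (F.depth f <_) F.depth-root f<g)

      fits-bounded : ∀ {d} → Bounded d → Fits d
      fits-bounded {d} bounded = fits-by-height _ bounded ≤-refl d refl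

      fits-all : ∀ d → Fits d
      fits-all d with dart-classification d
      ... | inj₁ tree              = fits-tree tree
      ... | inj₂ (inj₁ toParent)   = fits-bounded (F.toParent-≢root toParent)
      ... | inj₂ (inj₂ toParent-α) = fits-α (fits-bounded (F.toParent-≢root toParent-α))

    ℓ-potential : IsPotential w ℓ
    ℓ-potential d = decidable-stable (fits? d) λ unfit →
      faces-reachable λ reachable → unfit (fits-all reachable d)

  triangulated-potential :
    (w : Fin nD → ℕ) → (∀ d → w (α d) + w d ≡₃ 0) →
    (∀ d → Bounded d → iter φ 3 d ≡ d × φ d ≢ d) →
    (∀ d → Bounded d → w d + w (φ d) + w (φ (φ d)) ≡₃ 0) →
    Fin nV → ∃ (IsPotential w)
  triangulated-potential w w-α triangular w-triangle r = ℓ , ℓ-potential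
    where open PotentialConstruction w w-α triangular w-triangle r

  cost-α : ∀ d → cost (α d) + cost d ≡₃ 0
  cost-α d rewrite fwd-α d with fwd d
  ... | true  = residues refl
  ... | false = residues refl

  cost-thrice : ∀ d → cost d + cost d + cost d ≡₃ 0
  cost-thrice d with fwd d
  ... | true  = residues refl
  ... | false = residues refl

  module CAT0 (cat0 : IsCAT0Planar Q) where
    open IsCAT0Planar cat0

    bounded-φ : ∀ {d} → Bounded d → Bounded (φ d)
    bounded-φ {d} bounded = bounded ∘ trans (sym (fc-φ d))

    fwd-φφ : ∀ {d} → Bounded d → fwd (φ (φ d)) ≡ fwd d
    fwd-φφ {d} bounded = trans (bounded-cyclic (φ d) (bounded-φ bounded)) (bounded-cyclic d bounded)

    cost-triangle : ∀ d → Bounded d → cost d + cost (φ d) + cost (φ (φ d)) ≡₃ 0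
    cost-triangle d bounded = subst₂ (λ c₁ c₂ → cost d + c₁ + c₂ ≡₃ 0)
      (cong (λ b → if b then 1 else 2) (sym (bounded-cyclic d bounded)))
      (cong (λ b → if b then 1 else 2) (sym (fwd-φφ bounded)))
      (cost-thrice d)

    cost-potential : Fin nV → ∃ (IsPotential cost)
    cost-potential = triangulated-potential cost cost-α bounded-triangle cost-triangle

  module Distances {ℓ : Fin nV → ℕ} (potential : IsPotential cost ℓ) (v : Fin nV) where
    open ≡₃-Reasoning

    walk-potential : ∀ {u x c} → Walk u x c → ℓ x ≡₃ ℓ u + c
    walk-potential (nil u) = residues (cong (_% 3) (sym (+-identityʳ (ℓ u))))
    walk-potential {x = x} (step {c = c} d refl rest) = begin
      ℓ x                        ≈⟨ walk-potential rest ⟩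
      ℓ (vtx (α d)) + c          ≈⟨ ≡₃-+ʳ c (potential d) ⟩
      ℓ (vtx d) + cost d + c     ≡⟨ +-assoc (ℓ (vtx d)) (cost d) c ⟩
      ℓ (vtx d) + (cost d + c)   ∎

    dist-≡₃ : ∀ {d p q} → IsDist (vtx d) v p → IsDist (vtx (α d)) v q → p ≡₃ cost d + q
    dist-≡₃ {d} {p} {q} (walk-p , _) (walk-q , _) = ≡₃-cancelˡ (ℓ (vtx d)) (begin
      ℓ (vtx d) + p              ≈⟨ walk-potential walk-p ⟨
      ℓ v                        ≈⟨ walk-potential walk-q ⟩
      ℓ (vtx (α d)) + q          ≈⟨ ≡₃-+ʳ q (potential d) ⟩
      ℓ (vtx d) + cost d + q     ≡⟨ +-assoc (ℓ (vtx d)) (cost d) q ⟩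
      ℓ (vtx d) + (cost d + q)   ∎)

    dist-step : ∀ {d p q} → IsDist (vtx d) v p → IsDist (vtx (α d)) v q → p ≤ cost d + q
    dist-step (_ , minimal) (walk-q , _) = minimal _ (step _ refl walk-q)

    dist-αα : ∀ {d p} → IsDist (vtx d) v p → IsDist (vtx (α (α d))) v p
    dist-αα {d} {p} = subst (λ e → IsDist (vtx e) v p) (sym (αα d))

    forward-↝ : ∀ {d p q} → fwd d ≡ true → IsDist (vtx d) v p → IsDist (vtx (α d)) v q → p ↝ q
    forward-↝ {d} {p} {q} forward dist-p dist-q = ↝-from-bounds
      (subst (λ k → p ≤ k + q) cost₁ (dist-step dist-p dist-q))
      (subst (λ k → q ≤ k + p) cost₂ (dist-step dist-q (dist-αα dist-p)))
      (subst (λ k → p ≡₃ k + q) cost₁ (dist-≡₃ dist-p dist-q))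
      where
      cost₁ : cost d ≡ 1
      cost₁ = cong (λ b → if b then 1 else 2) forward
      cost₂ : cost (α d) ≡ 2
      cost₂ = cong (λ b → if b then 1 else 2) (trans (fwd-α d) (cong not forward))

    dist-along : ∀ {d p q} → IsDist (vtx d) v p → IsDist (vtx (α d)) v q → Along (fwd d) p q
    dist-along {d} dist-p dist-q with fwd d in orientation
    ... | true  = forward-↝ orientation dist-p dist-q
    ... | false = forward-↝ (trans (fwd-α d) (cong not orientation)) dist-q (dist-αα dist-p)

    dist-along-φ : ∀ {d p q} → IsDist (vtx d) v p → IsDist (vtx (φ d)) v q → Along (fwd d) p q
    dist-along-φ {d} {q = q} dist-p dist-q =
      dist-along dist-p (subst (λ x → IsDist x v q) (vtx-φ d) dist-q)

lemma9p3 : (Q : OrientedPlaneGraph) → IsCAT0Planar Q →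
           let open OrientedPlaneGraph Q in
           (v : Fin nV) (t : Fin nD) → Bounded t →
           (a b c : ℕ) →
           IsDist (vtx t) v a → IsDist (vtx (φ t)) v b → IsDist (vtx (φ (φ t))) v c →
           ∃ λ k → InSomeOrder a b c k
lemma9p3 Q cat0 v t bounded a b c dist-a dist-b dist-c = along-cycle (fwd t)
  (dist-along-φ dist-a dist-b)
  (subst (λ o → Along o b c) (bounded-cyclic t bounded) (dist-along-φ dist-b dist-c))
  (subst (λ o → Along o c a) (fwd-φφ bounded) (dist-along-φ dist-c dist-a′))
  where
  open OrientedPlaneGraph Q
  open IsCAT0Planar cat0
  open PlaneGraph Q
  open CAT0 cat0
  potential : ∃ (IsPotential cost)
  potential = cost-potential (vtx t)
  open Distances {proj₁ potential} (proj₂ potential) v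
  dist-a′ : IsDist (vtx (φ (φ (φ t)))) v a
  dist-a′ = subst (λ x → IsDist (vtx x) v a) (sym (proj₁ (bounded-triangle t bounded))) dist-a
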